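{- Let $n\ge 1$ and let $u$ be a vertex of the Fibonacci cube $\Gamma_n$. Then $${\rm ecc}_{\Gamma_{n}}(u) = {\rm depth}_{T_{n+1}}(\theta^{ -1}(u))\,,$$ where $T_{n+1}$ is the Fibonacci tree and $\theta$ is the labeling of its leaves described in the context.
   Context: A Fibonacci string of length $n$ is a binary string $b_1\ldots b_n$ with $b_i b_{i+1}=0$ for $1\le i<n$; let $\mathcal{F}_n$ be the set of them. The Fibonacci cube $\Gamma_n$ is the subgraph of the hypercube $Q_n$ (binary strings of length $n$, adjacent iff they differ in exactly one position) induced by $\mathcal{F}_n$; ${\rm ecc}_{\Gamma_n}(u)$ is the maximum distance in $\Gamma_n$ from $u$ to any vertex. Fibonacci trees are rooted binary trees defined by: $T_0$ and $T_1$ consist of a single vertex (the root); for $n\ge 2$, $T_n$ is the rooted tree whose root has left subtree $T_{n-1}$ and right subtree $T_{n-2}$. The depth of a leaf is its distance from the root. The labeling $\theta$ of the leaves of $T_n$ by the strings of $\mathcal{F}_{n-1}$ is defined recursively: the single leaf of $T_1$ gets the empty string; in $T_2$ the left leaf gets label $1$ and the right leaf gets label $0$; for $n\ge 3$, a leaf of $T_n$ lying in the right subtree (a copy of $T_{n-2}$) gets the label of the corresponding leaf of $T_{n-2}$ followed by $00$, and a leaf lying in the left subtree (a copy of $T_{n-1}$) gets the label $s$ of the corresponding leaf of $T_{n-1}$ followed by $0$ if $s$ ends with $1$, and followed by $1$ otherwise. This $\theta$ is a bijection between the leaves of $T_{n+1}$ and $V(\Gamma_n)=\mathcal{F}_n$.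 -}

module Defs where

open import Data.Nat using (ℕ; zero; suc; _≤_)
open import Data.Bool using (Bool; true; false; _∧_; if_then_else_)
open import Data.Fin using (Fin)
open import Data.Vec using (Vec; []; _∷_; _∷ʳ_; last; lookup; updateAt)
open import Data.Bool using (not)
open import Data.Product using (Σ; ∃; _×_)
open import Relation.Binary.PropositionalEquality using (_≡_)

-- Binary strings of length n are Vec Bool n, b₁ … bₙ left to right;
-- true = 1, false = 0.

data IsFib : {n : ℕ} → Vec Bool n → Set where
  fib-nil  : IsFib []
  fib-one  : (x : Bool) → IsFib (x ∷ [])
  fib-cons : {n : ℕ} (x y : Bool) (r : Vec Bool n) →
             x ∧ y ≡ false → IsFib (y ∷ r) → IsFib (x ∷ y ∷ r)

HypercubeAdj : {n : ℕ} → Vec Bool n → Vec Bool n → Set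
HypercubeAdj {n} u v = Σ (Fin n) λ i → v ≡ updateAt u i not

FibAdj : {n : ℕ} → Vec Bool n → Vec Bool n → Set
FibAdj u v = IsFib u × IsFib v × HypercubeAdj u v

data Walk {n : ℕ} : Vec Bool n → Vec Bool n → ℕ → Set where
  here : {u : Vec Bool n} → IsFib u → Walk u u 0
  step : {u w v : Vec Bool n} {k : ℕ} → FibAdj u w → Walk w v k → Walk u v (suc k)

Dist : {n : ℕ} → Vec Bool n → Vec Bool n → ℕ → Set
Dist u v d = Walk u v d × ((k : ℕ) → Walk u v k → d ≤ k)

Ecc : {n : ℕ} → Vec Bool n → ℕ → Set
Ecc u e = ((v : Vec Bool _) → IsFib v → ∃ λ d → Dist u v d × d ≤ e)
        × (∃ λ v → IsFib v × Dist u v e)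

-- Leaves of the Fibonacci tree Tₙ, represented by root-to-leaf paths.
data Leaf : ℕ → Set where
  leaf0 : Leaf 0
  leaf1 : Leaf 1
  left  : {n : ℕ} → Leaf (suc n) → Leaf (suc (suc n))
  right : {n : ℕ} → Leaf n → Leaf (suc (suc n))

depth : {n : ℕ} → Leaf n → ℕ
depth leaf0     = 0
depth leaf1     = 0
depth (left l)  = suc (depth l)
depth (right l) = suc (depth l)

θ : (n : ℕ) → Leaf (suc n) → Vec Bool n
θ zero leaf1 = []
θ (suc zero) (left leaf1) = true ∷ []
θ (suc zero) (right leaf0) = false ∷ []
θ (suc (suc n)) (left l) =
  let s = θ (suc n) l in s ∷ʳ (if last s then false else true)
θ (suc (suc n)) (right l) = (θ n l ∷ʳ false) ∷ʳ false

-- Γₙ is an isometric subgraph of Qₙ: between Fibonacci strings one can walk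
-- along a shortest hypercube path by clearing unwanted 1s before setting new
-- ones. Hence ecc(u) is the largest Hamming distance from u to a Fibonacci
-- string. Write E(s) for that maximum and E'(s) for the maximum over the
-- Fibonacci strings that stay Fibonacci after appending a 1. Comparing last
-- letters gives E(s1) = E(s) + 1, E'(s0) = E(s), E'(s) = E(s) when s ends in 1,
-- and E(s0) = E'(s) + 1 whenever E(s) ≤ E'(s) + 1. So each way θ extends a
-- label (s ↦ s1 for s ending in 0, s ↦ s0 for s ending in 1, s ↦ s00) adds 1
-- to E, just as it adds 1 to the depth.
module Submission where

open import Defs
open import Data.Nat using (ℕ; zero; suc; _≤_; _+_; z≤n; s≤s)
open import Data.Nat.Properties
  using ( ≤-refl; ≤-trans; ≤-antisym; m≤n⇒m≤1+n; +-mono-≤; +-monoˡ-≤; +-monoʳ-≤; +-suc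
        ; +-commutativeSemigroup)
open import Algebra.Properties.CommutativeSemigroup +-commutativeSemigroup using (x∙yz≈y∙xz)
open import Data.Bool using (Bool; true; false; not)
open import Data.Bool.Properties using (∧-zeroʳ)
open import Data.Fin using (Fin; zero; suc)
open import Data.Vec using (Vec; []; _∷_; _∷ʳ_; last; updateAt; initLast)
open import Data.Product using (∃; _×_; _,_; proj₁; proj₂)
open import Relation.Binary.PropositionalEquality using (_≡_; refl; sym; trans; cong; subst; subst₂)

mismatch : Bool → Bool → ℕ
mismatch false false = 0
mismatch true  true  = 0
mismatch false true  = 1
mismatch true  false = 1

hamming : {n : ℕ} → Vec Bool n → Vec Bool n → ℕ
hamming []       []       = 0
hamming (x ∷ xs) (y ∷ ys) = mismatch x y + hamming xs ys

mismatch≤1 : (x y : Bool) → mismatch x y ≤ 1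
mismatch≤1 false false = z≤n
mismatch≤1 false true  = ≤-refl
mismatch≤1 true  false = ≤-refl
mismatch≤1 true  true  = z≤n

mismatch-not : (x y : Bool) → mismatch x y ≤ suc (mismatch (not x) y)
mismatch-not false false = z≤n
mismatch-not false true  = s≤s z≤n
mismatch-not true  false = s≤s z≤n
mismatch-not true  true  = z≤n

hamming-refl : {n : ℕ} (u : Vec Bool n) → hamming u u ≡ 0
hamming-refl []          = refl
hamming-refl (false ∷ u) = hamming-refl u
hamming-refl (true ∷ u)  = hamming-refl u

hamming-updateAt-not : {n : ℕ} (u v : Vec Bool n) (i : Fin n) →
                       hamming u v ≤ suc (hamming (updateAt u i not) v)
hamming-updateAt-not (x ∷ xs) (y ∷ ys) zero = +-monoˡ-≤ (hamming xs ys) (mismatch-not x y)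
hamming-updateAt-not (x ∷ xs) (y ∷ ys) (suc i) =
  subst (mismatch x y + hamming xs ys ≤_) (+-suc (mismatch x y) (hamming (updateAt xs i not) ys))
        (+-monoʳ-≤ (mismatch x y) (hamming-updateAt-not xs ys i))

-- The last mismatch is put in front so that it reduces once the letters are known.
hamming-∷ʳ : {n : ℕ} (u v : Vec Bool n) (a b : Bool) →
             hamming (u ∷ʳ a) (v ∷ʳ b) ≡ mismatch a b + hamming u v
hamming-∷ʳ []      []      a b = refl
hamming-∷ʳ (x ∷ u) (y ∷ v) a b =
  trans (cong (mismatch x y +_) (hamming-∷ʳ u v a b)) (x∙yz≈y∙xz (mismatch x y) (mismatch a b) (hamming u v))

hamming≤length : {n : ℕ} {u v : Vec Bool n} {k : ℕ} → Walk u v k → hamming u v ≤ k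
hamming≤length {u = u} (here _) = subst (_≤ 0) (sym (hamming-refl u)) ≤-refl
hamming≤length {u = u} {v} (step (_ , _ , i , refl) w) =
  ≤-trans (hamming-updateAt-not u v i) (s≤s (hamming≤length w))

IsFib-tail : {n : ℕ} {x : Bool} {r : Vec Bool n} → IsFib (x ∷ r) → IsFib r
IsFib-tail {r = []} _               = fib-nil
IsFib-tail (fib-cons _ _ _ _ fibR) = fibR

IsFib-false∷ : {n : ℕ} {r : Vec Bool n} → IsFib r → IsFib (false ∷ r)
IsFib-false∷ fib-nil                  = fib-one false
IsFib-false∷ (fib-one x)              = fib-cons false x [] refl (fib-one x)
IsFib-false∷ fibR@(fib-cons x y r _ _) = fib-cons false x (y ∷ r) refl fibR

IsFib-true∷false∷ : {n : ℕ} {r : Vec Bool n} → IsFib r → IsFib (true ∷ false ∷ r)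
IsFib-true∷false∷ fibR = fib-cons true false _ refl (IsFib-false∷ fibR)

IsFib-init : {n : ℕ} (s : Vec Bool n) {c : Bool} → IsFib (s ∷ʳ c) → IsFib s
IsFib-init []          _                       = fib-nil
IsFib-init (x ∷ [])    _                       = fib-one x
IsFib-init (x ∷ y ∷ r) (fib-cons _ _ _ xy fib) = fib-cons x y r xy (IsFib-init (y ∷ r) fib)

IsFib-∷ʳ-false : {n : ℕ} (s : Vec Bool n) → IsFib s → IsFib (s ∷ʳ false)
IsFib-∷ʳ-false []          _                       = fib-one false
IsFib-∷ʳ-false (x ∷ [])    _                       = fib-cons x false [] (∧-zeroʳ x) (fib-one false)
IsFib-∷ʳ-false (x ∷ y ∷ r) (fib-cons _ _ _ xy fib) =
  fib-cons x y (r ∷ʳ false) xy (IsFib-∷ʳ-false (y ∷ r) fib)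

Extendable : {n : ℕ} → Vec Bool n → Set
Extendable s = IsFib (s ∷ʳ true)

Extendable-∷ʳ-false : {n : ℕ} (s : Vec Bool n) → IsFib s → Extendable (s ∷ʳ false)
Extendable-∷ʳ-false []          _ = fib-cons false true [] refl (fib-one true)
Extendable-∷ʳ-false (x ∷ [])    _ = fib-cons x false _ (∧-zeroʳ x) (fib-cons false true [] refl (fib-one true))
Extendable-∷ʳ-false (x ∷ y ∷ r) (fib-cons _ _ _ xy fib) = fib-cons x y _ xy (Extendable-∷ʳ-false (y ∷ r) fib)

Extendable-last : {n : ℕ} (s : Vec Bool n) (c : Bool) → Extendable (s ∷ʳ c) → c ≡ false
Extendable-last []          false _                     = refl
Extendable-last []          true  (fib-cons _ _ _ () _)
Extendable-last (x ∷ [])    c     (fib-cons _ _ _ _ fib) = Extendable-last [] c fib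
Extendable-last (x ∷ y ∷ r) c     (fib-cons _ _ _ _ fib) = Extendable-last (y ∷ r) c fib

Walk-∷ʳ : {n : ℕ} {a b c : Vec Bool n} {k : ℕ} → Walk a b k → FibAdj b c → Walk a c (suc k)
Walk-∷ʳ (here _)   adj = step adj (here (proj₁ (proj₂ adj)))
Walk-∷ʳ (step e w) adj = step e (Walk-∷ʳ w adj)

Walk-false∷ : {n : ℕ} {r s : Vec Bool n} {k : ℕ} → Walk r s k → Walk (false ∷ r) (false ∷ s) k
Walk-false∷ (here fib) = here (IsFib-false∷ fib)
Walk-false∷ (step (fibR , fibS , i , refl) w) =
  step (IsFib-false∷ fibR , IsFib-false∷ fibS , suc i , refl) (Walk-false∷ w)

Walk-true∷false∷ : {n : ℕ} {r s : Vec Bool n} {k : ℕ} →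
                   Walk r s k → Walk (true ∷ false ∷ r) (true ∷ false ∷ s) k
Walk-true∷false∷ (here fib) = here (IsFib-true∷false∷ fib)
Walk-true∷false∷ (step (fibR , fibS , i , refl) w) =
  step (IsFib-true∷false∷ fibR , IsFib-true∷false∷ fibS , suc (suc i) , refl) (Walk-true∷false∷ w)

-- A leading 1 of the source is cleared first, a leading 1 of the target set last.
hamming-walk : {n : ℕ} (u v : Vec Bool n) → IsFib u → IsFib v → Walk u v (hamming u v)
hamming-walk []           []           _    _    = here fib-nil
hamming-walk (false ∷ []) (false ∷ []) fibU _    = here fibU
hamming-walk (true ∷ [])  (true ∷ [])  fibU _    = here fibU
hamming-walk (false ∷ []) (true ∷ [])  fibU fibV = step (fibU , fibV , zero , refl) (here fibV)
hamming-walk (true ∷ [])  (false ∷ []) fibU fibV = step (fibU , fibV , zero , refl) (here fibV)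
hamming-walk (true ∷ true ∷ u) _ (fib-cons _ _ _ () _) _
hamming-walk _ (true ∷ true ∷ v) _ (fib-cons _ _ _ () _)
hamming-walk (false ∷ a ∷ u) (false ∷ b ∷ v) fibU fibV =
  Walk-false∷ (hamming-walk (a ∷ u) (b ∷ v) (IsFib-tail fibU) (IsFib-tail fibV))
hamming-walk (true ∷ false ∷ u) (true ∷ false ∷ v) fibU fibV =
  Walk-true∷false∷ (hamming-walk u v (IsFib-tail (IsFib-tail fibU)) (IsFib-tail (IsFib-tail fibV)))
hamming-walk (true ∷ false ∷ u) (false ∷ b ∷ v) fibU fibV =
  step (fibU , IsFib-false∷ (IsFib-tail fibU) , zero , refl)
       (Walk-false∷ (hamming-walk (false ∷ u) (b ∷ v) (IsFib-tail fibU) (IsFib-tail fibV)))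
hamming-walk (false ∷ a ∷ u) (true ∷ false ∷ v) fibU fibV =
  Walk-∷ʳ (Walk-false∷ (hamming-walk (a ∷ u) (false ∷ v) (IsFib-tail fibU) (IsFib-tail fibV)))
          (IsFib-false∷ (IsFib-tail fibV) , fibV , zero , refl)

Dist-hamming : {n : ℕ} (u v : Vec Bool n) → IsFib u → IsFib v → Dist u v (hamming u v)
Dist-hamming u v fibU fibV = hamming-walk u v fibU fibV , λ _ → hamming≤length

MaxHamming : {n : ℕ} → (Vec Bool n → Set) → Vec Bool n → ℕ → Set
MaxHamming {n} P u m = ((v : Vec Bool n) → P v → hamming u v ≤ m)
                     × (∃ λ v → P v × hamming u v ≡ m)

hamming-∷ʳ-≤ : {n : ℕ} (s : Vec Bool n) (a : Bool) {m : ℕ} →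
               ((v : Vec Bool n) → IsFib v → hamming s v ≤ m) →
               (w : Vec Bool (suc n)) → IsFib w → hamming (s ∷ʳ a) w ≤ suc m
hamming-∷ʳ-≤ s a bound w fibW with initLast w
... | v , c , refl = subst (_≤ _) (sym (hamming-∷ʳ s v a c))
                       (+-mono-≤ (mismatch≤1 a c) (bound v (IsFib-init v fibW)))

maxHamming-∷ʳ-true : {n : ℕ} (s : Vec Bool n) {m : ℕ} →
                     MaxHamming IsFib s m → MaxHamming IsFib (s ∷ʳ true) (suc m)
maxHamming-∷ʳ-true s (bound , v , fibV , refl) =
  hamming-∷ʳ-≤ s true bound , v ∷ʳ false , IsFib-∷ʳ-false v fibV , hamming-∷ʳ s v true false

maxHamming-∷ʳ-false-Extendable : {n : ℕ} (s : Vec Bool n) {m : ℕ} →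
                                 MaxHamming IsFib s m → MaxHamming Extendable (s ∷ʳ false) m
maxHamming-∷ʳ-false-Extendable s {m} (bound , v , fibV , refl) =
  bound′ , v ∷ʳ false , Extendable-∷ʳ-false v fibV , hamming-∷ʳ s v false false
  where
  bound′ : (w : Vec Bool _) → Extendable w → hamming (s ∷ʳ false) w ≤ m
  bound′ w extW with initLast w
  ... | v′ , c , refl with Extendable-last v′ c extW
  ... | refl = subst (_≤ m) (sym (hamming-∷ʳ s v′ false false))
                 (bound v′ (IsFib-init v′ (IsFib-init (v′ ∷ʳ false) extW)))

-- Flipping the last letter of a farthest string to 0 cannot decrease its
-- distance from a string ending in 1.
maxHamming-Extendable-∷ʳ-true : {n : ℕ} (s : Vec Bool n) {m : ℕ} →
                                MaxHamming IsFib (s ∷ʳ true) m → MaxHamming Extendable (s ∷ʳ true) m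
maxHamming-Extendable-∷ʳ-true s {m} (bound , w , fibW , dist≡m) with initLast w
... | v , d , refl =
  (λ x extX → bound x (IsFib-init x extX)) ,
  v ∷ʳ false , Extendable-∷ʳ-false v fibV ,
  ≤-antisym (bound _ (IsFib-∷ʳ-false v fibV)) m≤
  where
  fibV : IsFib v
  fibV = IsFib-init v fibW
  m≤ : m ≤ hamming (s ∷ʳ true) (v ∷ʳ false)
  m≤ = subst₂ _≤_ (trans (sym (hamming-∷ʳ s v true d)) dist≡m) (sym (hamming-∷ʳ s v true false))
              (+-monoˡ-≤ (hamming s v) (mismatch≤1 true d))

maxHamming-Extendable-last-true : {n : ℕ} (s : Vec Bool (suc n)) {m : ℕ} → last s ≡ true →
                                  MaxHamming IsFib s m → MaxHamming Extendable s m
maxHamming-Extendable-last-true s lastS≡true with initLast s | lastS≡true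
... | s′ , true , refl | refl = maxHamming-Extendable-∷ʳ-true s′

maxHamming-∷ʳ-false : {n : ℕ} (s : Vec Bool n) {m : ℕ} →
                      ((v : Vec Bool n) → IsFib v → hamming s v ≤ suc m) →
                      MaxHamming Extendable s m → MaxHamming IsFib (s ∷ʳ false) (suc m)
maxHamming-∷ʳ-false s {m} bound (boundExt , v , extV , refl) =
  bound′ , v ∷ʳ true , extV , hamming-∷ʳ s v false true
  where
  bound′ : (w : Vec Bool _) → IsFib w → hamming (s ∷ʳ false) w ≤ suc m
  bound′ w fibW with initLast w
  ... | v′ , false , refl =
    subst (_≤ suc m) (sym (hamming-∷ʳ s v′ false false)) (bound v′ (IsFib-init v′ fibW))
  ... | v′ , true  , refl =
    subst (_≤ suc m) (sym (hamming-∷ʳ s v′ false true)) (s≤s (boundExt v′ fibW))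

maxHamming-θ : (n : ℕ) (l : Leaf (suc n)) → MaxHamming IsFib (θ n l) (depth l)
maxHamming-θ zero leaf1 = (λ { [] _ → z≤n }) , [] , fib-nil , refl
maxHamming-θ (suc zero) (left leaf1)  = (λ { (x ∷ []) _ → +-mono-≤ (mismatch≤1 true x) z≤n })
                                      , false ∷ [] , fib-one false , refl
maxHamming-θ (suc zero) (right leaf0) = (λ { (x ∷ []) _ → +-mono-≤ (mismatch≤1 false x) z≤n })
                                      , true ∷ [] , fib-one true , refl
maxHamming-θ (suc (suc n)) (left l) with last (θ (suc n) l) in lastS
... | true  = maxHamming-∷ʳ-false s (λ v fibV → m≤n⇒m≤1+n (proj₁ ih v fibV))
                (maxHamming-Extendable-last-true s lastS ih)
  where
  s : Vec Bool (suc n)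
  s = θ (suc n) l
  ih : MaxHamming IsFib s (depth l)
  ih = maxHamming-θ (suc n) l
... | false = maxHamming-∷ʳ-true (θ (suc n) l) (maxHamming-θ (suc n) l)
maxHamming-θ (suc (suc n)) (right l) =
  maxHamming-∷ʳ-false (θ n l ∷ʳ false) (hamming-∷ʳ-≤ (θ n l) false (proj₁ ih))
    (maxHamming-∷ʳ-false-Extendable (θ n l) ih)
  where
  ih : MaxHamming IsFib (θ n l) (depth l)
  ih = maxHamming-θ n l

Ecc-maxHamming : {n : ℕ} {u : Vec Bool n} {m : ℕ} → IsFib u → MaxHamming IsFib u m → Ecc u m
Ecc-maxHamming {u = u} fibU (bound , v , fibV , dist≡m) =
  (λ w fibW → hamming u w , Dist-hamming u w fibU fibW , bound w fibW) ,
  v , fibV , subst (Dist u v) dist≡m (Dist-hamming u v fibU fibV)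

theorem3p1 : (n : ℕ) → 1 ≤ n → (u : Vec Bool n) → IsFib u →
             (l : Leaf (suc n)) → θ n l ≡ u → Ecc u (depth l)
theorem3p1 n _ u fibU l refl = Ecc-maxHamming fibU (maxHamming-θ n l)
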